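{- Let $F,G\colon\mathbb{F}_2^n\to\mathbb{F}_2^n$ satisfy $F(Ax+e)=BG(x)+d$ for all $x\in\mathbb{F}_2^n$, where $A,B$ are invertible $n\times n$ matrices over $\mathbb{F}_2$ with $AS=S^kA$ and $BS=S^kB$ for some $1\leq k\leq n$, and $d,e\in\{(0,0,\dotsc,0),(1,1,\dotsc,1)\}$. Then: (i) for every $1\leq m\leq n$, $F$ is $m$-shift-invariant if and only if $G$ is $m$-shift-invariant; (ii) $F$ is cyclic if and only if $G$ is cyclic; (iii) $F$ is bijective if and only if $G$ is bijective.
   Context: $S$ is the right cyclic shift on $\mathbb{F}_2^n$, $S(x_1,\dotsc,x_n)=(x_n,x_1,\dotsc,x_{n-1})$. A function $H\colon\mathbb{F}_2^n\to\mathbb{F}_2^n$ is $m$-shift-invariant if $H\circ S=S^m\circ H$. The cycle of $x$ is $c(x)=\{S^j(x):j\in\mathbb{Z}\}$; $H$ is cyclic if for every cycle $X$, $H(X)$ is contained in a cycle. -}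

module Defs where

open import Data.Nat using (ℕ; zero; suc)
open import Data.Fin using (Fin; zero; suc; fromℕ; inject₁)
open import Data.Fin.Properties using (_≟_)
open import Data.Bool using (Bool; true; false; _∧_; _xor_)
open import Data.Vec using (Vec; tabulate; lookup; replicate; zipWith)
open import Data.Product using (∃)
open import Data.Sum using (_⊎_)
open import Relation.Nullary.Decidable using (⌊_⌋)
open import Relation.Binary.PropositionalEquality using (_≡_)
open import Function using (_∘_)

-- F₂ is modelled by Bool (addition = xor, multiplication = ∧).
-- Elements of F₂^n are Vec Bool n; coordinates x₁ … xₙ are indices 0 … n-1.

cycPred : ∀ {n} → Fin n → Fin n
cycPred {suc n} zero = fromℕ n
cycPred {suc n} (suc i) = inject₁ i

S : ∀ {n} → Vec Bool n → Vec Bool n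
S x = tabulate (λ i → lookup x (cycPred i))

iter : ∀ {A : Set} → ℕ → (A → A) → A → A
iter zero f a = a
iter (suc k) f a = f (iter k f a)

Sᵏ : ∀ {n} → ℕ → Vec Bool n → Vec Bool n
Sᵏ k = iter k S

_⊕_ : ∀ {n} → Vec Bool n → Vec Bool n → Vec Bool n
_⊕_ = zipWith _xor_

𝟘 𝟙 : ∀ n → Vec Bool n
𝟘 n = replicate n false
𝟙 n = replicate n true

Mat : ℕ → Set
Mat n = Fin n → Fin n → Bool

bigXor : ∀ {n} → (Fin n → Bool) → Bool
bigXor {zero} f = false
bigXor {suc n} f = f zero xor bigXor (f ∘ suc)

_·_ : ∀ {n} → Mat n → Mat n → Mat n
(A · B) i j = bigXor (λ l → A i l ∧ B l j)

_▹_ : ∀ {n} → Mat n → Vec Bool n → Vec Bool n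
A ▹ x = tabulate (λ i → bigXor (λ j → A i j ∧ lookup x j))

I : ∀ {n} → Mat n
I i j = ⌊ i ≟ j ⌋

_^_ : ∀ {n} → Mat n → ℕ → Mat n
A ^ zero = I
A ^ suc k = A · (A ^ k)

_≈_ : ∀ {n} → Mat n → Mat n → Set
A ≈ B = ∀ i j → A i j ≡ B i j

Smat : ∀ {n} → Mat n
Smat i j = ⌊ j ≟ cycPred i ⌋

Invertible : ∀ {n} → Mat n → Set
Invertible {n} A = ∃ λ (C : Mat n) → ((A · C) ≈ I) × ((C · A) ≈ I)
  where open import Data.Product using (_×_)

ShiftInvariant : ∀ {n} → ℕ → (Vec Bool n → Vec Bool n) → Set
ShiftInvariant m H = ∀ x → H (S x) ≡ Sᵏ m (H x)

-- y lies in the cycle of x: y = S^j x for some j (S^n = id, so j ∈ ℕ suffices)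
InCycle : ∀ {n} → Vec Bool n → Vec Bool n → Set
InCycle y x = ∃ λ j → y ≡ Sᵏ j x

Cyclic : ∀ {n} → (Vec Bool n → Vec Bool n) → Set
Cyclic {n} H = ∀ (x : Vec Bool n) → ∃ λ (y : Vec Bool n) →
  ∀ z → InCycle z x → InCycle (H z) y

Constant : ∀ {n} → Vec Bool n → Set
Constant {n} d = (d ≡ 𝟘 n) ⊎ (d ≡ 𝟙 n)

module Submission where

-- Put α x = A x + e and β x = B x + d, so that the hypothesis reads F ∘ α = β ∘ G and both α and β
-- are bijections with α ∘ S = Sᵏ ∘ α.  Conjugation by α carries S to Sᵏ, so Sᵏ has the same
-- order n as S; hence k is a unit modulo n, and for k k′ ≡ 1 (mod n) the inverses satisfy
-- α⁻¹ ∘ S = Sᵏ′ ∘ α⁻¹.  Thus G = β⁻¹ ∘ F ∘ α and F = β ∘ G ∘ α⁻¹ arise from each other by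
-- composing with maps that turn S into a power of S.  Such compositions preserve m-shift
-- invariance (the exponent k m k′ collapses to m), send cycles into cycles, and preserve
-- bijectivity.

open import Defs
open import Algebra.Bundles using (CommutativeRing)
open import Data.Bool using (Bool; true; false; _∧_; _xor_)
open import Data.Bool.Properties using (xor-∧-commutativeRing; ∧-assoc; xor-assoc; xor-same; xor-identityʳ)
open import Data.Fin using (Fin; zero; suc; toℕ)
open import Data.Fin.Properties using (_≟_; suc-injective; toℕ-injective; toℕ<n; toℕ-fromℕ; toℕ-inject₁)
open import Data.Nat using (ℕ; zero; suc; _+_; _*_; _%_; _≤_; z≤n; NonZero)
open import Data.Nat.Coprimality using (Coprime; coprime-Bézout)
open import Data.Nat.Divisibility using (_∣_; divides; *-cancelˡ-∣; ∣1⇒≡1; m%n≡0⇒n∣m)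
open import Data.Nat.DivMod using (n%n≡0; m<n⇒m%n≡m; [m+n]%n≡m%n; %-distribˡ-+; m%n%n≡m%n)
open import Data.Nat.GCD using (module Bézout)
open import Data.Nat.Properties using (+-suc; +-identityʳ; *-comm; *-identityʳ; *-commutativeSemigroup)
open import Data.Nat.Tactic.RingSolver using (solve-∀)
open import Algebra.Properties.CommutativeSemigroup *-commutativeSemigroup using (x∙yz≈y∙xz; xy∙z≈y∙xz)
open import Data.Product using (∃; _×_; _,_; proj₁; proj₂)
open import Data.Sum using (inj₁; inj₂)
open import Data.Vec using (Vec; []; _∷_; lookup; replicate)
open import Data.Vec.Properties
  using (lookup∘tabulate; tabulate∘lookup; tabulate-cong; lookup-replicate; lookup-zipWith)
open import Data.Vec.Relation.Binary.Pointwise.Extensional using (ext; Pointwise-≡⇒≡)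
open import Function using (_∘_; _⇔_; mk⇔)
open import Function.Construct.Composition using () renaming (bijective to ∘-bijective)
open import Function.Consequences.Propositional using (inverseᵇ⇒bijective; inverseʳ⇒injective;
  strictlyInverseˡ⇒inverseˡ; strictlyInverseʳ⇒inverseʳ)
open import Function.Definitions using (Bijective; Injective)
open import Relation.Binary.PropositionalEquality
open import Relation.Nullary.Decidable using (⌊_⌋)

open import Algebra.Properties.Semiring.Sum (CommutativeRing.semiring xor-∧-commutativeRing)
  using (sum; sum-cong-≗; sum-replicate-zero; ∑-comm; *-distribˡ-sum; *-distribʳ-sum)

bigXor≡sum : ∀ {n} (f : Fin n → Bool) → bigXor f ≡ sum f
bigXor≡sum {zero} f = refl
bigXor≡sum {suc n} f = cong (f zero xor_) (bigXor≡sum (f ∘ suc))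

bigXor-cong : ∀ {n} {f g : Fin n → Bool} → (∀ i → f i ≡ g i) → bigXor f ≡ bigXor g
bigXor-cong {f = f} {g} f≗g = trans (bigXor≡sum f) (trans (sum-cong-≗ f≗g) (sym (bigXor≡sum g)))

bigXor-comm : ∀ {m n} (f : Fin m → Fin n → Bool) →
              bigXor (λ i → bigXor (λ j → f i j)) ≡ bigXor (λ j → bigXor (λ i → f i j))
bigXor-comm f = begin
  bigXor (λ i → bigXor (f i))           ≡⟨ bigXor-cong (λ i → bigXor≡sum (f i)) ⟩
  bigXor (λ i → sum (f i))              ≡⟨ bigXor≡sum (λ i → sum (f i)) ⟩
  sum (λ i → sum (f i))                 ≡⟨ ∑-comm f ⟩
  sum (λ j → sum (λ i → f i j))         ≡⟨ sym (bigXor≡sum (λ j → sum (λ i → f i j))) ⟩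
  bigXor (λ j → sum (λ i → f i j))      ≡⟨ sym (bigXor-cong (λ j → bigXor≡sum (λ i → f i j))) ⟩
  bigXor (λ j → bigXor (λ i → f i j))   ∎
  where open ≡-Reasoning

∧-distribˡ-bigXor : ∀ {n} a (f : Fin n → Bool) → a ∧ bigXor f ≡ bigXor (λ i → a ∧ f i)
∧-distribˡ-bigXor a f =
  trans (cong (a ∧_) (bigXor≡sum f)) (trans (*-distribˡ-sum a f) (sym (bigXor≡sum (λ i → a ∧ f i))))

∧-distribʳ-bigXor : ∀ {n} a (f : Fin n → Bool) → bigXor f ∧ a ≡ bigXor (λ i → f i ∧ a)
∧-distribʳ-bigXor a f =
  trans (cong (_∧ a) (bigXor≡sum f)) (trans (*-distribʳ-sum a f) (sym (bigXor≡sum (λ i → f i ∧ a))))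

bigXor-select : ∀ {n} (p : Fin n) (δ f : Fin n → Bool) → δ p ≡ true → (∀ j → j ≢ p → δ j ≡ false) →
                bigXor (λ j → δ j ∧ f j) ≡ f p
bigXor-select {suc n} zero δ f δp≡true δj≡false rewrite δp≡true =
  trans (cong (f zero xor_) (trans (bigXor≡sum (λ j → δ (suc j) ∧ f (suc j)))
    (trans (sum-cong-≗ (λ j → cong (_∧ f (suc j)) (δj≡false (suc j) λ ()))) (sum-replicate-zero n))))
    (xor-identityʳ (f zero))
bigXor-select (suc p) δ f δp≡true δj≡false rewrite δj≡false zero (λ ()) =
  bigXor-select p (δ ∘ suc) (f ∘ suc) δp≡true (λ j j≢p → δj≡false (suc j) (j≢p ∘ suc-injective))

▹-· : ∀ {n} (M N : Mat n) x → (M · N) ▹ x ≡ M ▹ (N ▹ x)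
▹-· M N x = tabulate-cong λ i → begin
    bigXor (λ j → bigXor (λ l → M i l ∧ N l j) ∧ xⱼ j)
  ≡⟨ bigXor-cong (λ j → ∧-distribʳ-bigXor (xⱼ j) (λ l → M i l ∧ N l j)) ⟩
    bigXor (λ j → bigXor (λ l → (M i l ∧ N l j) ∧ xⱼ j))
  ≡⟨ bigXor-comm (λ j l → (M i l ∧ N l j) ∧ xⱼ j) ⟩
    bigXor (λ l → bigXor (λ j → (M i l ∧ N l j) ∧ xⱼ j))
  ≡⟨ bigXor-cong (λ l → trans (bigXor-cong (λ j → ∧-assoc (M i l) (N l j) (xⱼ j)))
                               (sym (∧-distribˡ-bigXor (M i l) (λ j → N l j ∧ xⱼ j)))) ⟩
    bigXor (λ l → M i l ∧ bigXor (λ j → N l j ∧ xⱼ j))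
  ≡⟨ bigXor-cong (λ l → cong (M i l ∧_) (sym (lookup∘tabulate _ l))) ⟩
    bigXor (λ l → M i l ∧ lookup (N ▹ x) l) ∎
  where open ≡-Reasoning
        xⱼ = lookup x

▹-cong : ∀ {n} {M N : Mat n} → M ≈ N → ∀ x → M ▹ x ≡ N ▹ x
▹-cong M≈N x = tabulate-cong (λ i → bigXor-cong (λ j → cong (_∧ lookup x j) (M≈N i j)))

I▹ : ∀ {n} (x : Vec Bool n) → I ▹ x ≡ x
I▹ x = trans (tabulate-cong λ i → bigXor-select i (λ j → ⌊ i ≟ j ⌋) (lookup x)
                (cong ⌊_⌋ (≡-≟-identity _≟_ refl)) (λ j j≢i → cong ⌊_⌋ (≢-≟-identity _≟_ (j≢i ∘ sym))))
             (tabulate∘lookup x)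

Smat▹ : ∀ {n} (x : Vec Bool n) → Smat ▹ x ≡ S x
Smat▹ x = tabulate-cong λ i → bigXor-select (cycPred i) (λ j → ⌊ j ≟ cycPred i ⌋) (lookup x)
  (cong ⌊_⌋ (≡-≟-identity _≟_ refl)) (λ j j≢pi → cong ⌊_⌋ (≢-≟-identity _≟_ j≢pi))

Smat^▹ : ∀ {n} k (x : Vec Bool n) → (Smat ^ k) ▹ x ≡ Sᵏ k x
Smat^▹ zero x = I▹ x
Smat^▹ (suc k) x = trans (▹-· Smat (Smat ^ k) x) (trans (Smat▹ ((Smat ^ k) ▹ x)) (cong S (Smat^▹ k x)))

iter-+ : ∀ {A : Set} a b (f : A → A) x → iter (a + b) f x ≡ iter a f (iter b f x)
iter-+ zero b f x = refl
iter-+ (suc a) b f x = cong f (iter-+ a b f x)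

iter-* : ∀ {A : Set} a b (f : A → A) x → iter (a * b) f x ≡ iter a (iter b f) x
iter-* zero b f x = refl
iter-* (suc a) b f x = trans (iter-+ b (a * b) f x) (cong (iter b f) (iter-* a b f x))

iter-cong : ∀ {A : Set} {f g : A → A} → (∀ x → f x ≡ g x) → ∀ a x → iter a f x ≡ iter a g x
iter-cong f≗g zero x = refl
iter-cong {g = g} f≗g (suc a) x = trans (f≗g _) (cong g (iter-cong f≗g a x))

iter-semiconj : ∀ {A B : Set} {f : A → A} {g : B → B} (h : A → B) →
                (∀ x → h (f x) ≡ g (h x)) → ∀ a x → h (iter a f x) ≡ iter a g (h x)
iter-semiconj h hf≗gh zero x = refl
iter-semiconj {f = f} {g} h hf≗gh (suc a) x = trans (hf≗gh (iter a f x)) (cong g (iter-semiconj h hf≗gh a x))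

[m%n+k]%n≡[m+k]%n : ∀ m k n .{{_ : NonZero n}} → (m % n + k) % n ≡ (m + k) % n
[m%n+k]%n≡[m+k]%n m k n = begin
  (m % n + k) % n           ≡⟨ %-distribˡ-+ (m % n) k n ⟩
  (m % n % n + k % n) % n   ≡⟨ cong (λ a → (a + k % n) % n) (m%n%n≡m%n m n) ⟩
  (m % n + k % n) % n       ≡⟨ sym (%-distribˡ-+ m k n) ⟩
  (m + k) % n               ∎
  where open ≡-Reasoning

m*n∣m⇒n≡1 : ∀ m n .{{_ : NonZero m}} → m * n ∣ m → n ≡ 1
m*n∣m⇒n≡1 m n m*n∣m = ∣1⇒≡1 (*-cancelˡ-∣ m (subst (m * n ∣_) (sym (*-identityʳ m)) m*n∣m))

toℕ-cycPred : ∀ {m} (i : Fin (suc m)) → suc (toℕ (cycPred i)) % suc m ≡ toℕ i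
toℕ-cycPred {m} zero = trans (cong (λ a → suc a % suc m) (toℕ-fromℕ m)) (n%n≡0 (suc m))
toℕ-cycPred {m} (suc i) = trans (cong (λ a → suc a % suc m) (toℕ-inject₁ i)) (m<n⇒m%n≡m (toℕ<n (suc i)))

toℕ-iter-cycPred : ∀ {m} j (i : Fin (suc m)) → (toℕ (iter j cycPred i) + j) % suc m ≡ toℕ i
toℕ-iter-cycPred {m} zero i = trans (cong (_% suc m) (+-identityʳ (toℕ i))) (m<n⇒m%n≡m (toℕ<n i))
toℕ-iter-cycPred {m} (suc j) i = begin
  (toℕ (cycPred t) + suc j) % n            ≡⟨ cong (_% n) (+-suc (toℕ (cycPred t)) j) ⟩
  (suc (toℕ (cycPred t)) + j) % n          ≡⟨ sym ([m%n+k]%n≡[m+k]%n (suc (toℕ (cycPred t))) j n) ⟩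
  (suc (toℕ (cycPred t)) % n + j) % n      ≡⟨ cong (λ a → (a + j) % n) (toℕ-cycPred t) ⟩
  (toℕ t + j) % n                          ≡⟨ toℕ-iter-cycPred j i ⟩
  toℕ i                                    ∎
  where open ≡-Reasoning
        n = suc m
        t = iter j cycPred i

iter-cycPred-period : ∀ {m} (i : Fin (suc m)) → iter (suc m) cycPred i ≡ i
iter-cycPred-period {m} i = toℕ-injective (begin
  toℕ c                   ≡⟨ sym (m<n⇒m%n≡m (toℕ<n c)) ⟩
  toℕ c % suc m           ≡⟨ sym ([m+n]%n≡m%n (toℕ c) (suc m)) ⟩
  (toℕ c + suc m) % suc m ≡⟨ toℕ-iter-cycPred (suc m) i ⟩
  toℕ i                   ∎)
  where open ≡-Reasoning
        c = iter (suc m) cycPred i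

iter-cycPred-zero⇒∣ : ∀ {m} j → iter j cycPred (zero {m}) ≡ zero → suc m ∣ j
iter-cycPred-zero⇒∣ {m} j fixes-zero =
  m%n≡0⇒n∣m j (suc m) (subst (λ c → (toℕ c + j) % suc m ≡ 0) fixes-zero (toℕ-iter-cycPred j zero))

lookup-Sᵏ : ∀ {n} j (x : Vec Bool n) i → lookup (Sᵏ j x) i ≡ lookup x (iter j cycPred i)
lookup-Sᵏ zero x i = refl
lookup-Sᵏ (suc j) x i = begin
  lookup (S (Sᵏ j x)) i                  ≡⟨ lookup∘tabulate _ i ⟩
  lookup (Sᵏ j x) (cycPred i)            ≡⟨ lookup-Sᵏ j x (cycPred i) ⟩
  lookup x (iter j cycPred (cycPred i))  ≡⟨ cong (lookup x) (sym (iter-semiconj cycPred (λ _ → refl) j i)) ⟩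
  lookup x (cycPred (iter j cycPred i))  ∎
  where open ≡-Reasoning

Sᵏ-period : ∀ {n} (x : Vec Bool n) → Sᵏ n x ≡ x
Sᵏ-period {zero} x = refl
Sᵏ-period {suc m} x =
  Pointwise-≡⇒≡ (ext λ i → trans (lookup-Sᵏ (suc m) x i) (cong (lookup x) (iter-cycPred-period i)))

Sᵏ-*-period : ∀ {n} q (x : Vec Bool n) → Sᵏ (q * n) x ≡ x
Sᵏ-*-period zero x = refl
Sᵏ-*-period {n} (suc q) x = trans (iter-+ n (q * n) S x) (trans (cong (Sᵏ n) (Sᵏ-*-period q x)) (Sᵏ-period x))

Sᵏ-+-period : ∀ {n} j q (x : Vec Bool n) → Sᵏ (j + q * n) x ≡ Sᵏ j x
Sᵏ-+-period {n} j q x = trans (iter-+ j (q * n) S x) (cong (Sᵏ j) (Sᵏ-*-period q x))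

lookup-true∷replicate≡true⇒zero : ∀ {m} (i : Fin (suc m)) →
                                  lookup (true ∷ replicate m false) i ≡ true → i ≡ zero
lookup-true∷replicate≡true⇒zero zero _ = refl
lookup-true∷replicate≡true⇒zero (suc i) eq with () ← trans (sym (lookup-replicate i false)) eq

Sᵏ≗id⇒∣ : ∀ {m} j → (∀ (x : Vec Bool (suc m)) → Sᵏ j x ≡ x) → suc m ∣ j
Sᵏ≗id⇒∣ {m} j Sʲ≗id = iter-cycPred-zero⇒∣ j (lookup-true∷replicate≡true⇒zero (iter j cycPred zero)
  (trans (sym (lookup-Sᵏ j e₀ zero)) (cong (λ v → lookup v zero) (Sʲ≗id e₀))))
  where e₀ = true ∷ replicate m false

Sᵏ-⊕ : ∀ {n} j (u v : Vec Bool n) → Sᵏ j (u ⊕ v) ≡ Sᵏ j u ⊕ Sᵏ j v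
Sᵏ-⊕ j u v = Pointwise-≡⇒≡ (ext λ i → let c = iter j cycPred i in begin
  lookup (Sᵏ j (u ⊕ v)) i                      ≡⟨ lookup-Sᵏ j (u ⊕ v) i ⟩
  lookup (u ⊕ v) c                             ≡⟨ lookup-zipWith _xor_ c u v ⟩
  lookup u c xor lookup v c                    ≡⟨ sym (cong₂ _xor_ (lookup-Sᵏ j u i) (lookup-Sᵏ j v i)) ⟩
  lookup (Sᵏ j u) i xor lookup (Sᵏ j v) i      ≡⟨ sym (lookup-zipWith _xor_ i (Sᵏ j u) (Sᵏ j v)) ⟩
  lookup (Sᵏ j u ⊕ Sᵏ j v) i                   ∎)
  where open ≡-Reasoning

Sᵏ-replicate : ∀ {n} j (b : Bool) → Sᵏ j (replicate n b) ≡ replicate n b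
Sᵏ-replicate {n} j b = Pointwise-≡⇒≡ (ext λ i →
  trans (lookup-Sᵏ j (replicate n b) i) (trans (lookup-replicate (iter j cycPred i) b) (sym (lookup-replicate i b))))

Sᵏ-Constant : ∀ {n} j {e : Vec Bool n} → Constant e → Sᵏ j e ≡ e
Sᵏ-Constant j (inj₁ refl) = Sᵏ-replicate j false
Sᵏ-Constant j (inj₂ refl) = Sᵏ-replicate j true

ShiftInvariant-Sᵏ : ∀ {n a} {f : Vec Bool n → Vec Bool n} → ShiftInvariant a f →
                    ∀ j x → f (Sᵏ j x) ≡ Sᵏ (j * a) (f x)
ShiftInvariant-Sᵏ {a = a} {f} f-inv j x = trans (iter-semiconj f f-inv j x) (sym (iter-* j a S (f x)))

ShiftInvariant-∘ : ∀ {n a b} {f g : Vec Bool n → Vec Bool n} →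
                   ShiftInvariant a f → ShiftInvariant b g → ShiftInvariant (b * a) (f ∘ g)
ShiftInvariant-∘ {b = b} {f} {g} f-inv g-inv x = trans (cong f (g-inv x)) (ShiftInvariant-Sᵏ f-inv b (g x))

ShiftInvariant-InCycle : ∀ {n a} {f : Vec Bool n → Vec Bool n} → ShiftInvariant a f →
                         ∀ {z x} → InCycle z x → InCycle (f z) (f x)
ShiftInvariant-InCycle {a = a} f-inv {x = x} (j , refl) = j * a , ShiftInvariant-Sᵏ f-inv j x

ShiftInvariant-inverse : ∀ {n k k′} (f g : Vec Bool n → Vec Bool n) →
                         (∀ x → g (f x) ≡ x) → (∀ y → f (g y) ≡ y) →
                         ShiftInvariant k f → (∀ x → Sᵏ (k * k′) x ≡ S x) → ShiftInvariant k′ g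
ShiftInvariant-inverse {k = k} {k′} f g g∘f f∘g f-inv Sᵏᵏ′≗S y = begin
  g (S y)                 ≡⟨ cong g (sym (Sᵏᵏ′≗S y)) ⟩
  g (Sᵏ (k * k′) y)       ≡⟨ cong (λ j → g (Sᵏ j y)) (*-comm k k′) ⟩
  g (Sᵏ (k′ * k) y)       ≡⟨ cong g (iter-* k′ k S y) ⟩
  g (iter k′ (Sᵏ k) y)    ≡⟨ iter-semiconj g g∘Sᵏ≗S∘g k′ y ⟩
  Sᵏ k′ (g y)             ∎
  where
    open ≡-Reasoning
    g∘Sᵏ≗S∘g : ∀ w → g (Sᵏ k w) ≡ S (g w)
    g∘Sᵏ≗S∘g w = trans (cong (g ∘ Sᵏ k) (sym (f∘g w))) (trans (cong g (sym (f-inv (g w)))) (g∘f (S (g w))))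

-- For a common divisor d of k and n = q d, injectivity of f transports S^(q k) = id back to
-- S^q = id, so n ∣ q and therefore d = 1.
injective-ShiftInvariant⇒coprime : ∀ {m k} {f : Vec Bool (suc m) → Vec Bool (suc m)} →
                                   Injective _≡_ _≡_ f → ShiftInvariant k f → Coprime k (suc m)
injective-ShiftInvariant⇒coprime f-inj f-inv (divides p k≡p*d , divides zero ())
injective-ShiftInvariant⇒coprime {m} {k} {f} f-inj f-inv {d} (divides p k≡p*d , divides q@(suc _) n≡q*d) =
  m*n∣m⇒n≡1 q d (subst (_∣ q) n≡q*d (Sᵏ≗id⇒∣ q Sᵠ≗id))
  where
    open ≡-Reasoning
    q*k≡p*n : q * k ≡ p * suc m
    q*k≡p*n = begin
      q * k        ≡⟨ cong (q *_) k≡p*d ⟩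
      q * (p * d)  ≡⟨ x∙yz≈y∙xz q p d ⟩
      p * (q * d)  ≡⟨ cong (p *_) (sym n≡q*d) ⟩
      p * suc m    ∎
    Sᵠ≗id : ∀ x → Sᵏ q x ≡ x
    Sᵠ≗id x = f-inj (begin
      f (Sᵏ q x)            ≡⟨ ShiftInvariant-Sᵏ {a = k} {f} f-inv q x ⟩
      Sᵏ (q * k) (f x)      ≡⟨ cong (λ j → Sᵏ j (f x)) q*k≡p*n ⟩
      Sᵏ (p * suc m) (f x)  ≡⟨ Sᵏ-*-period p (f x) ⟩
      f x                   ∎)

coprime⇒Sᵏ-unit : ∀ {m k} → Coprime k (suc m) →
                  ∃ λ k′ → ∀ (x : Vec Bool (suc m)) → Sᵏ (k * k′) x ≡ S x
coprime⇒Sᵏ-unit {m} {k} k⊥n with coprime-Bézout k⊥n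
... | Bézout.+- a b 1+b*n≡a*k = a , λ x → begin
  Sᵏ (k * a) x            ≡⟨ cong (λ j → Sᵏ j x) (trans (*-comm k a) (sym 1+b*n≡a*k)) ⟩
  Sᵏ (1 + b * suc m) x    ≡⟨ Sᵏ-+-period 1 b x ⟩
  S x                     ∎
  where open ≡-Reasoning
-- Here a k ≡ -1 (mod n), so a (n - 1) = a m is an inverse of k.
... | Bézout.-+ a b 1+a*k≡b*n = a * m , λ x → begin
  Sᵏ (k * (a * m)) x                  ≡⟨ sym (Sᵏ-+-period (k * (a * m)) 1 x) ⟩
  Sᵏ (k * (a * m) + 1 * suc m) x      ≡⟨ cong (λ j → Sᵏ j x) ka[n-1]+n≡1+b[n-1]n ⟩
  Sᵏ (1 + b * m * suc m) x            ≡⟨ Sᵏ-+-period 1 (b * m) x ⟩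
  S x                                 ∎
  where
    open ≡-Reasoning
    ka[n-1]+n≡1+b[n-1]n : k * (a * m) + 1 * suc m ≡ 1 + b * m * suc m
    ka[n-1]+n≡1+b[n-1]n = begin
      k * (a * m) + 1 * suc m   ≡⟨ expand k a m ⟩
      (1 + a * k) * m + 1       ≡⟨ cong (λ t → t * m + 1) 1+a*k≡b*n ⟩
      b * suc m * m + 1         ≡⟨ rearrange b m ⟩
      1 + b * m * suc m         ∎
      where expand : ∀ k a m → k * (a * m) + 1 * (1 + m) ≡ (1 + a * k) * m + 1
            expand = solve-∀
            rearrange : ∀ b m → b * (1 + m) * m + 1 ≡ 1 + b * m * (1 + m)
            rearrange = solve-∀

⊕-cancelʳ : ∀ {n} (u v : Vec Bool n) → (u ⊕ v) ⊕ v ≡ u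
⊕-cancelʳ [] [] = refl
⊕-cancelʳ (a ∷ u) (b ∷ v) =
  cong₂ _∷_ (trans (xor-assoc a b b) (trans (cong (a xor_) (xor-same b)) (xor-identityʳ a))) (⊕-cancelʳ u v)

▹-inverse : ∀ {n} (A C : Mat n) → (A · C) ≈ I → ∀ y → A ▹ (C ▹ y) ≡ y
▹-inverse A C AC≈I y = trans (sym (▹-· A C y)) (trans (▹-cong AC≈I y) (I▹ y))

▹-ShiftInvariant : ∀ {n k} {A : Mat n} → (A · Smat) ≈ ((Smat ^ k) · A) → ShiftInvariant k (A ▹_)
▹-ShiftInvariant {k = k} {A} AS≈SᵏA x = begin
  A ▹ S x                  ≡⟨ cong (A ▹_) (sym (Smat▹ x)) ⟩
  A ▹ (Smat ▹ x)           ≡⟨ sym (▹-· A Smat x) ⟩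
  (A · Smat) ▹ x           ≡⟨ ▹-cong AS≈SᵏA x ⟩
  ((Smat ^ k) · A) ▹ x     ≡⟨ ▹-· (Smat ^ k) A x ⟩
  (Smat ^ k) ▹ (A ▹ x)     ≡⟨ Smat^▹ k (A ▹ x) ⟩
  Sᵏ k (A ▹ x)             ∎
  where open ≡-Reasoning

ShiftInvariant-⊕-Constant : ∀ {n k} {f : Vec Bool n → Vec Bool n} {e : Vec Bool n} →
                            ShiftInvariant k f → Constant e → ShiftInvariant k (λ x → f x ⊕ e)
ShiftInvariant-⊕-Constant {k = k} {f} {e} f-inv e-const x = begin
  f (S x) ⊕ e                ≡⟨ cong₂ _⊕_ (f-inv x) (sym (Sᵏ-Constant k e-const)) ⟩
  Sᵏ k (f x) ⊕ Sᵏ k e        ≡⟨ sym (Sᵏ-⊕ k (f x) e) ⟩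
  Sᵏ k (f x ⊕ e)             ∎
  where open ≡-Reasoning

invertible-intertwiner⇒Sᵏ-unit : ∀ {m k} {A : Mat (suc m)} → Invertible A → (A · Smat) ≈ ((Smat ^ k) · A) →
                                 ∃ λ k′ → ∀ x → Sᵏ (k * k′) x ≡ S x
invertible-intertwiner⇒Sᵏ-unit {k = k} {A} (C , _ , CA≈I) AS≈SᵏA =
  coprime⇒Sᵏ-unit (injective-ShiftInvariant⇒coprime {k = k} {A ▹_} A-injective (▹-ShiftInvariant {k = k} {A} AS≈SᵏA))
  where
    A-injective : Injective _≡_ _≡_ (A ▹_)
    A-injective = inverseʳ⇒injective (A ▹_) (strictlyInverseʳ⇒inverseʳ {f⁻¹ = C ▹_} (A ▹_) (▹-inverse C A CA≈I))

record ShiftConjugacy (n k k′ : ℕ) : Set where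
  field
    to from    : Vec Bool n → Vec Bool n
    from∘to    : ∀ x → from (to x) ≡ x
    to∘from    : ∀ y → to (from y) ≡ y
    to-shift   : ShiftInvariant k to
    from-shift : ShiftInvariant k′ from

  Sᵏ-unit : ∀ x → Sᵏ (k * k′) x ≡ S x
  Sᵏ-unit x = begin
    Sᵏ (k * k′) x              ≡⟨ cong (Sᵏ (k * k′)) (sym (from∘to x)) ⟩
    Sᵏ (k * k′) (from (to x))  ≡⟨ sym (ShiftInvariant-Sᵏ from-shift k (to x)) ⟩
    from (Sᵏ k (to x))         ≡⟨ cong from (sym (to-shift x)) ⟩
    from (to (S x))            ≡⟨ from∘to (S x) ⟩
    S x                        ∎
    where open ≡-Reasoning

  to-bijective : Bijective _≡_ _≡_ to
  to-bijective =
    inverseᵇ⇒bijective (strictlyInverseˡ⇒inverseˡ to to∘from , strictlyInverseʳ⇒inverseʳ to from∘to)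

  inverse : ShiftConjugacy n k′ k
  inverse = record { to = from ; from = to ; from∘to = to∘from ; to∘from = from∘to
                   ; to-shift = from-shift ; from-shift = to-shift }

open ShiftConjugacy

affineShiftConjugacy : ∀ {n k k′} (A : Mat n) (e : Vec Bool n) → Invertible A →
                       (A · Smat) ≈ ((Smat ^ k) · A) → Constant e → (∀ x → Sᵏ (k * k′) x ≡ S x) →
                       ShiftConjugacy n k k′
affineShiftConjugacy {k = k} A e (C , AC≈I , CA≈I) AS≈SᵏA e-const Sᵏᵏ′≗S = record
  { to         = to′
  ; from       = from′
  ; from∘to    = from∘to′
  ; to∘from    = to∘from′
  ; to-shift   = to-shift′
  ; from-shift = ShiftInvariant-inverse {k = k} to′ from′ from∘to′ to∘from′ to-shift′ Sᵏᵏ′≗S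
  }
  where
    to′ from′ : Vec Bool _ → Vec Bool _
    to′ x = (A ▹ x) ⊕ e
    from′ y = C ▹ (y ⊕ e)
    from∘to′ : ∀ x → C ▹ (((A ▹ x) ⊕ e) ⊕ e) ≡ x
    from∘to′ x = trans (cong (C ▹_) (⊕-cancelʳ (A ▹ x) e)) (▹-inverse C A CA≈I x)
    to∘from′ : ∀ y → (A ▹ (C ▹ (y ⊕ e))) ⊕ e ≡ y
    to∘from′ y = trans (cong (_⊕ e) (▹-inverse A C AC≈I (y ⊕ e))) (⊕-cancelʳ y e)
    to-shift′ : ShiftInvariant k to′
    to-shift′ = ShiftInvariant-⊕-Constant {k = k} {f = A ▹_} (▹-ShiftInvariant {k = k} AS≈SᵏA) e-const

Bijective-≗ : ∀ {A B : Set} {f g : A → B} → (∀ x → f x ≡ g x) →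
              Bijective _≡_ _≡_ f → Bijective _≡_ _≡_ g
Bijective-≗ f≗g (f-inj , f-sur) =
  (λ {x} {y} gx≡gy → f-inj (trans (f≗g x) (trans gx≡gy (sym (f≗g y))))) ,
  (λ y → proj₁ (f-sur y) , λ z≡x → trans (sym (f≗g _)) (proj₂ (f-sur y) z≡x))

conjugate-inverse : ∀ {n k k′} (α β : ShiftConjugacy n k k′) {F G : Vec Bool n → Vec Bool n} →
                    (∀ x → F (to α x) ≡ to β (G x)) → ∀ y → G (from α y) ≡ from β (F y)
conjugate-inverse α β {F} {G} F∘α≗β∘G y = begin
  G (from α y)                     ≡⟨ sym (from∘to β (G (from α y))) ⟩
  from β (to β (G (from α y)))     ≡⟨ cong (from β) (sym (F∘α≗β∘G (from α y))) ⟩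
  from β (F (to α (from α y)))     ≡⟨ cong (from β ∘ F) (to∘from α y) ⟩
  from β (F y)                     ∎
  where open ≡-Reasoning

module Transfer {n k k′} (α β : ShiftConjugacy n k k′) {F G : Vec Bool n → Vec Bool n}
                (F∘α≗β∘G : ∀ x → F (to α x) ≡ to β (G x)) where

  G≗β⁻¹∘F∘α : ∀ x → G x ≡ from β (F (to α x))
  G≗β⁻¹∘F∘α x = trans (sym (from∘to β (G x))) (cong (from β) (sym (F∘α≗β∘G x)))

  shiftInvariant : ∀ m → ShiftInvariant m F → ShiftInvariant m G
  shiftInvariant m F-inv x = begin
    G (S x)                          ≡⟨ G≗β⁻¹∘F∘α (S x) ⟩
    from β (F (to α (S x)))          ≡⟨ β⁻¹∘F∘α-shift x ⟩
    Sᵏ (k * m * k′) y                ≡⟨ cong (λ j → Sᵏ j y) (xy∙z≈y∙xz k m k′) ⟩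
    Sᵏ (m * (k * k′)) y              ≡⟨ iter-* m (k * k′) S y ⟩
    iter m (Sᵏ (k * k′)) y           ≡⟨ iter-cong (Sᵏ-unit α) m y ⟩
    Sᵏ m y                           ≡⟨ cong (Sᵏ m) (sym (G≗β⁻¹∘F∘α x)) ⟩
    Sᵏ m (G x)                       ∎
    where
      open ≡-Reasoning
      y = from β (F (to α x))
      β⁻¹∘F∘α-shift : ShiftInvariant (k * m * k′) (from β ∘ F ∘ to α)
      β⁻¹∘F∘α-shift = ShiftInvariant-∘ {a = k′} {k * m} {from β} {F ∘ to α} (from-shift β)
                        (ShiftInvariant-∘ {a = m} {k} {F} {to α} F-inv (to-shift α))

  cyclic : Cyclic F → Cyclic G
  cyclic F-cyc x = from β w , λ z z∈c[x] → subst (λ v → InCycle v (from β w)) (sym (G≗β⁻¹∘F∘α z))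
      (ShiftInvariant-InCycle {a = k′} {from β} (from-shift β)
        (F-orbit (to α z) (ShiftInvariant-InCycle {a = k} {to α} (to-shift α) z∈c[x])))
    where w = proj₁ (F-cyc (to α x))
          F-orbit = proj₂ (F-cyc (to α x))

  bijective : Bijective _≡_ _≡_ F → Bijective _≡_ _≡_ G
  bijective F-bij = Bijective-≗ (sym ∘ G≗β⁻¹∘F∘α)
    (∘-bijective _≡_ _≡_ _≡_ (∘-bijective _≡_ _≡_ _≡_ (to-bijective α) F-bij) (to-bijective (inverse β)))

mainTheorem11 : ∀ (n : ℕ) (F G : Vec Bool n → Vec Bool n) (A B : Mat n) (d e : Vec Bool n) (k : ℕ) →
    Invertible A → Invertible B →
    1 ≤ k → k ≤ n →
    (A · Smat) ≈ ((Smat ^ k) · A) →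
    (B · Smat) ≈ ((Smat ^ k) · B) →
    Constant d → Constant e →
    (∀ x → F ((A ▹ x) ⊕ e) ≡ (B ▹ (G x)) ⊕ d) →
    ((∀ m → 1 ≤ m → m ≤ n → (ShiftInvariant m F ⇔ ShiftInvariant m G))
     × (Cyclic F ⇔ Cyclic G)
     × (Bijective _≡_ _≡_ F ⇔ Bijective _≡_ _≡_ G))
-- The bounds 1 ≤ k ≤ n only exclude n = 0: invertibility of A already makes k a unit modulo n.
mainTheorem11 zero _ _ _ _ _ _ .zero _ _ () z≤n _ _ _ _ _
mainTheorem11 (suc _) F G A B d e k A-inv B-inv _ _ AS≈SᵏA BS≈SᵏB d-const e-const F∘α≗β∘G =
  (λ m _ _ → mk⇔ (F⇒G.shiftInvariant m) (G⇒F.shiftInvariant m)) ,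
  mk⇔ F⇒G.cyclic G⇒F.cyclic ,
  mk⇔ F⇒G.bijective G⇒F.bijective
  where
    k⁻¹ = invertible-intertwiner⇒Sᵏ-unit {k = k} {A} A-inv AS≈SᵏA
    α = affineShiftConjugacy {k = k} {proj₁ k⁻¹} A e A-inv AS≈SᵏA e-const (proj₂ k⁻¹)
    β = affineShiftConjugacy {k = k} {proj₁ k⁻¹} B d B-inv BS≈SᵏB d-const (proj₂ k⁻¹)
    module F⇒G = Transfer α β {F} {G} F∘α≗β∘G
    module G⇒F = Transfer (inverse α) (inverse β) {G} {F} (conjugate-inverse α β {F} {G} F∘α≗β∘G)
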